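{- Let $M$ be a matroid. Then $M$ is supersolvable if and only if each of its connected components is supersolvable. Similarly, $M$ is saturated if and only if each of its connected components is saturated.
   Context: A flat $F$ of a matroid $M$ is modular if $r(F)+r(F')=r(F\cap F')+r(F\cup F')$ for every flat $F'$. A rank-$r$ matroid is supersolvable if it has a chain of modular flats $F_0\subseteq\cdots\subseteq F_r$ with $r(F_i)=i$. A vertical cover of $M$ is a pair of flats $(F_1,F_2)$, neither equal to $E(M)$, with $F_1\cup F_2=E(M)$; a flat $F$ is round if $M|F$ has no vertical cover. $M$ is saturated if every round flat of $M$ is modular. -}

module Defs where

open import Data.Nat using (ℕ; suc; _≤_; _<_; _+_; _∸_)
open import Data.Fin using (Fin; toℕ)
open import Data.Fin.Subset using (Subset; _∈_; _∉_; _⊆_; _∩_; _∪_; ⁅_⁆; ∣_∣)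
open import Data.Product using (_×_; Σ; ∃; _,_)
open import Relation.Binary.PropositionalEquality using (_≡_)
open import Relation.Binary.Construct.Closure.ReflexiveTransitive using (Star)
open import Relation.Nullary using (¬_)
open import Function.Bundles using (_⇔_)

-- A (finite) matroid on ground set E ⊆ Fin n, given by its rank function r
-- (only its values on subsets of E matter), via the standard rank axioms.
record IsMatroid {n : ℕ} (E : Subset n) (r : Subset n → ℕ) : Set where
  field
    rank-bound : ∀ X → X ⊆ E → r X ≤ ∣ X ∣
    rank-mono  : ∀ X Y → Y ⊆ E → X ⊆ Y → r X ≤ r Y
    rank-submod : ∀ X Y → X ⊆ E → Y ⊆ E → r (X ∪ Y) + r (X ∩ Y) ≤ r X + r Y

-- The restriction M|X of the matroid (E , r) to X ⊆ E is simply (X , r).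

module _ {n : ℕ} (E : Subset n) (r : Subset n → ℕ) where

  IsFlat : Subset n → Set
  IsFlat F = F ⊆ E × (∀ e → e ∈ E → e ∉ F → ¬ (r (F ∪ ⁅ e ⁆) ≡ r F))

  IsModularFlat : Subset n → Set
  IsModularFlat F = IsFlat F ×
    (∀ F′ → IsFlat F′ → r F + r F′ ≡ r (F ∩ F′) + r (F ∪ F′))

  IsSupersolvable : Set
  IsSupersolvable = Σ (Fin (suc (r E)) → Subset n) λ F →
      (∀ i → IsModularFlat (F i))
    × (∀ i → r (F i) ≡ toℕ i)
    × (∀ i j → toℕ i ≤ toℕ j → F i ⊆ F j)

  HasVerticalCover : Set
  HasVerticalCover = Σ (Subset n) λ F₁ → Σ (Subset n) λ F₂ →
    IsFlat F₁ × IsFlat F₂ × ¬ (F₁ ≡ E) × ¬ (F₂ ≡ E) × (F₁ ∪ F₂ ≡ E)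

  IsCircuit : Subset n → Set
  IsCircuit C = C ⊆ E × r C < ∣ C ∣ ×
    (∀ Y → Y ⊆ C → ¬ (Y ≡ C) → r Y ≡ ∣ Y ∣)

  ShareCircuit : Fin n → Fin n → Set
  ShareCircuit e f = ∃ λ C → IsCircuit C × e ∈ C × f ∈ C

  IsComponent : Subset n → Set
  IsComponent C = ∃ λ e → e ∈ E × (∀ f → (f ∈ C) ⇔ (f ∈ E × Star ShareCircuit e f))

IsRoundFlat : {n : ℕ} → Subset n → (Subset n → ℕ) → Subset n → Set
IsRoundFlat E r F = IsFlat E r F × ¬ HasVerticalCover F r

IsSaturated : {n : ℕ} → Subset n → (Subset n → ℕ) → Set
IsSaturated E r = ∀ F → IsRoundFlat E r F → IsModularFlat E r F

module Submission where

-- Let C be a connected component of M.  No circuit meets both C and E ─ C, and a minimal set X on which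
-- r X = r (X ∩ C) + r (X ─ C) fails would be exactly such a circuit; so M = M|C ⊕ M|(E ─ C).  In a direct
-- sum E = S ⊕ T, flats and modular flats of M are the unions of flats (modular flats) of the two parts, and
-- a round flat of M meets S in a round flat of M|S.  Conversely a round flat A of M|S stays round in M
-- once the closure of ∅ in M|T is adjoined, which gives saturation of the parts.  A modular chain of M
-- cuts down to one of M|S because r (Fᵢ ∩ S) grows by at most one per step, and chains of the two parts
-- concatenate.  Induction on |E| over the components finishes both equivalences.

open import Defs
open import Data.Bool using (true; false)
import Data.Bool.Properties as Bool
open import Data.Empty using (⊥-elim)
open import Data.Fin using (Fin; toℕ)
open import Data.Fin.Properties using (any?; toℕ-fromℕ<; toℕ≤pred[n]) renaming (_≟_ to _≟ᶠ_)
open import Data.Fin.Subset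
open import Data.Fin.Subset.Properties
open import Data.Nat using (ℕ; zero; suc; _+_; _∸_; _≤_; _<_; z≤n; s≤s; _⊓_; _≤?_; _<?_)
open import Data.Nat.DivMod using (_mod_; m<n⇒m%n≡m)
open import Data.Nat.Induction using (<-wellFounded)
open import Data.Nat.Properties
open import Algebra.Properties.CommutativeSemigroup +-commutativeSemigroup
  using () renaming (interchange to +-interchange)
open import Data.Product using (_×_; _,_; proj₁; proj₂; Σ; ∃)
open import Data.Sum as Sum using (_⊎_; inj₁; inj₂; [_,_])
open import Data.Vec using ([]; _∷_; here; there)
open import Data.Vec.Properties using (≡-dec)
open import Function using (id)
open import Function.Bundles using (_⇔_; mk⇔; Equivalence)
open import Induction.WellFounded as WF using ()
import Relation.Binary.Construct.On as On
open import Relation.Binary.Construct.Closure.ReflexiveTransitive using (Star; ε; _◅_; _◅◅_; gmap)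
open import Relation.Binary.PropositionalEquality
  using (_≡_; _≢_; refl; sym; trans; cong; cong₂; subst; subst₂; module ≡-Reasoning)
open import Relation.Nullary using (¬_; Dec; yes; no; ¬?)
open import Relation.Nullary.Decidable using (_×-dec_; _→-dec_; decidable-stable; toSum)

private variable
  n : ℕ
  x y : Fin n
  p q s : Subset n
  E F S T X Y Z : Subset n
  r : Subset n → ℕ

-- Finite sets

<-measure-rec : {A : Set} (μ : A → ℕ) (P : A → Set) →
  (∀ a → (∀ {b} → μ b < μ a → P b) → P a) → ∀ a → P a
<-measure-rec μ P = WF.All.wfRec (On.wellFounded μ <-wellFounded) _ P

cardinality-rec : (P : Subset n → Set) →
  (∀ p → (∀ {q} → ∣ q ∣ < ∣ p ∣ → P q) → P p) → ∀ p → P p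
cardinality-rec = <-measure-rec ∣_∣

x∈p─q⁻ : ∀ (p q : Subset n) → x ∈ p ─ q → x ∈ p × x ∉ q
x∈p─q⁻ (_ ∷ p) (true ∷ q) (there x∈) with x∈p─q⁻ p q x∈
... | x∈p , x∉q = there x∈p , λ { (there x∈q) → x∉q x∈q }
x∈p─q⁻ (true ∷ p) (false ∷ q) here = here , λ ()
x∈p─q⁻ (_ ∷ p) (false ∷ q) (there x∈) with x∈p─q⁻ p q x∈
... | x∈p , x∉q = there x∈p , λ { (there x∈q) → x∉q x∈q }

x∈p⇒⁅x⁆⊆p : x ∈ p → ⁅ x ⁆ ⊆ p
x∈p⇒⁅x⁆⊆p {x = x} x∈p y∈ = subst (_∈ _) (sym (x∈⁅y⁆⇒x≡y x y∈)) x∈p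

∪-least : p ⊆ s → q ⊆ s → p ∪ q ⊆ s
∪-least {p = p} {q = q} p⊆s q⊆s x∈ = [ p⊆s , q⊆s ] (x∈p∪q⁻ p q x∈)

p⊆q⇒p∩s⊆q∩s : ∀ s → p ⊆ q → p ∩ s ⊆ q ∩ s
p⊆q⇒p∩s⊆q∩s {p = p} s p⊆q x∈ = let x∈p , x∈s = x∈p∩q⁻ p s x∈ in x∈p∩q⁺ (p⊆q x∈p , x∈s)

p⊆q⇒p∩q≡p : p ⊆ q → p ∩ q ≡ p
p⊆q⇒p∩q≡p {p = p} {q = q} p⊆q = ⊆-antisym (p∩q⊆p p q) (λ x∈p → x∈p∩q⁺ (x∈p , p⊆q x∈p))

p⊆q⇒p∪q≡q : p ⊆ q → p ∪ q ≡ q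
p⊆q⇒p∪q≡q {p = p} {q = q} p⊆q = ⊆-antisym (∪-least p⊆q ⊆-refl) (q⊆p∪q p q)

p⊆q⇒p∩[q∩s]≡p∩s : p ⊆ q → p ∩ (q ∩ s) ≡ p ∩ s
p⊆q⇒p∩[q∩s]≡p∩s {p = p} {q = q} {s = s} p⊆q =
  trans (sym (∩-assoc p q s)) (cong (_∩ s) (p⊆q⇒p∩q≡p p⊆q))

[p∩q]∩s≡[p∩s]∩[q∩s] : ∀ (p q s : Subset n) → (p ∩ q) ∩ s ≡ (p ∩ s) ∩ (q ∩ s)
[p∩q]∩s≡[p∩s]∩[q∩s] p q s = ⊆-antisym
  (λ x∈ → let x∈p∩q , x∈s = x∈p∩q⁻ (p ∩ q) s x∈
              x∈p , x∈q = x∈p∩q⁻ p q x∈p∩q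
          in x∈p∩q⁺ (x∈p∩q⁺ (x∈p , x∈s) , x∈p∩q⁺ (x∈q , x∈s)))
  (λ x∈ → let x∈p∩s , x∈q∩s = x∈p∩q⁻ (p ∩ s) (q ∩ s) x∈
              x∈p , x∈s = x∈p∩q⁻ p s x∈p∩s
              x∈q , _ = x∈p∩q⁻ q s x∈q∩s
          in x∈p∩q⁺ (x∈p∩q⁺ (x∈p , x∈q) , x∈s))

[p∪q]∪s≡[p∪s]∪q : ∀ (p q s : Subset n) → (p ∪ q) ∪ s ≡ (p ∪ s) ∪ q
[p∪q]∪s≡[p∪s]∪q p q s =
  trans (∪-assoc p q s) (trans (cong (p ∪_) (∪-comm q s)) (sym (∪-assoc p s q)))

[p∪s]∪[q∪s]≡[p∪q]∪s : ∀ (p q s : Subset n) → (p ∪ s) ∪ (q ∪ s) ≡ (p ∪ q) ∪ s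
[p∪s]∪[q∪s]≡[p∪q]∪s p q s = ⊆-antisym
  (∪-least (∪-least (⊆-trans (p⊆p∪q q) (p⊆p∪q s)) (q⊆p∪q _ s))
           (∪-least (⊆-trans (q⊆p∪q p q) (p⊆p∪q s)) (q⊆p∪q _ s)))
  (∪-least (∪-least (⊆-trans (p⊆p∪q s) (p⊆p∪q _)) (⊆-trans (p⊆p∪q s) (q⊆p∪q _ _)))
           (⊆-trans (q⊆p∪q p s) (p⊆p∪q _)))

[p─q]∩s≡[p∩s]─q : ∀ (p q s : Subset n) → (p ─ q) ∩ s ≡ (p ∩ s) ─ q
[p─q]∩s≡[p∩s]─q p q s = ⊆-antisym
  (λ x∈ → let x∈p─q , x∈s = x∈p∩q⁻ (p ─ q) s x∈
              x∈p , x∉q = x∈p─q⁻ p q x∈p─q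
          in x∈p∧x∉q⇒x∈p─q (x∈p∩q⁺ (x∈p , x∈s)) x∉q)
  (λ x∈ → let x∈p∩s , x∉q = x∈p─q⁻ (p ∩ s) q x∈
              x∈p , x∈s = x∈p∩q⁻ p s x∈p∩s
          in x∈p∩q⁺ (x∈p∧x∉q⇒x∈p─q x∈p x∉q , x∈s))

[p─q]∩s≡p∩s : ∀ (p q s : Subset n) → (∀ {x} → x ∈ q → x ∉ s) → (p ─ q) ∩ s ≡ p ∩ s
[p─q]∩s≡p∩s p q s q∩s-empty = ⊆-antisym
  (λ x∈ → let x∈p─q , x∈s = x∈p∩q⁻ (p ─ q) s x∈
          in x∈p∩q⁺ (proj₁ (x∈p─q⁻ p q x∈p─q) , x∈s))
  (λ x∈ → let x∈p , x∈s = x∈p∩q⁻ p s x∈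
          in x∈p∩q⁺ (x∈p∧x∉q⇒x∈p─q x∈p (λ x∈q → q∩s-empty x∈q x∈s) , x∈s))

∣p∪q∣≡∣p∣+∣q∣ : ∀ (p q : Subset n) → (∀ {x} → x ∈ p → x ∉ q) →
  ∣ p ∪ q ∣ ≡ ∣ p ∣ + ∣ q ∣
∣p∪q∣≡∣p∣+∣q∣ []          []          _        = refl
∣p∪q∣≡∣p∣+∣q∣ (true ∷ p)  (true ∷ q)  disjoint = ⊥-elim (disjoint here here)
∣p∪q∣≡∣p∣+∣q∣ (true ∷ p)  (false ∷ q) disjoint =
  cong suc (∣p∪q∣≡∣p∣+∣q∣ p q (λ x∈p x∈q → disjoint (there x∈p) (there x∈q)))
∣p∪q∣≡∣p∣+∣q∣ (false ∷ p) (true ∷ q)  disjoint =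
  trans (cong suc (∣p∪q∣≡∣p∣+∣q∣ p q (λ x∈p x∈q → disjoint (there x∈p) (there x∈q)))) (sym (+-suc _ _))
∣p∪q∣≡∣p∣+∣q∣ (false ∷ p) (false ∷ q) disjoint =
  ∣p∪q∣≡∣p∣+∣q∣ p q (λ x∈p x∈q → disjoint (there x∈p) (there x∈q))

∣p∣≤1+∣p-x∣ : ∀ (p : Subset n) x → ∣ p ∣ ≤ suc ∣ p - x ∣
∣p∣≤1+∣p-x∣ p x = begin
  ∣ p ∣                   ≤⟨ p⊆q⇒∣p∣≤∣q∣ p⊆[p-x]∪⁅x⁆ ⟩
  ∣ (p - x) ∪ ⁅ x ⁆ ∣     ≡⟨ ∣p∪q∣≡∣p∣+∣q∣ (p - x) ⁅ x ⁆ (λ y∈p-x → proj₂ (x∈p─q⁻ p ⁅ x ⁆ y∈p-x)) ⟩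
  ∣ p - x ∣ + ∣ ⁅ x ⁆ ∣   ≡⟨ cong (∣ p - x ∣ +_) (∣⁅x⁆∣≡1 x) ⟩
  ∣ p - x ∣ + 1           ≡⟨ +-comm _ 1 ⟩
  suc ∣ p - x ∣           ∎
  where
  open ≤-Reasoning
  p⊆[p-x]∪⁅x⁆ : p ⊆ (p - x) ∪ ⁅ x ⁆
  p⊆[p-x]∪⁅x⁆ {y} y∈p with y ≟ᶠ x
  ... | yes refl = x∈p∪q⁺ (inj₂ (x∈⁅x⁆ x))
  ... | no y≢x   = x∈p∪q⁺ (inj₁ (x∈p∧x≢y⇒x∈p-y y∈p y≢x))

⊆∧≢⇒⊂ : p ⊆ q → p ≢ q → p ⊂ q
⊆∧≢⇒⊂ {p = p} {q = q} p⊆q p≢q with any? (λ x → (x ∈? q) ×-dec ¬? (x ∈? p))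
... | yes (x , x∈q , x∉p) = p⊆q , x , x∈q , x∉p
... | no none = ⊥-elim (p≢q (⊆-antisym p⊆q q⊆p))
  where
  q⊆p : q ⊆ p
  q⊆p {x} x∈q = decidable-stable (x ∈? p) (λ x∉p → none (x , x∈q , x∉p))

allSubsets? : {P : Subset n → Set} → (∀ p → Dec (P p)) → Dec (∀ p → P p)
allSubsets? P? with anySubset? (λ p → ¬? (P? p))
... | yes (p , ¬Pp) = no λ all → ¬Pp (all p)
... | no none = yes λ p → decidable-stable (P? p) (λ ¬Pp → none (p , ¬Pp))

module _ (E : Subset n) (P : Subset n → Set)
         (Q : Subset n → Fin n → Set) (Q? : ∀ Y x → Dec (Q Y x))
         (Q-extends : ∀ {Y x} → x ∈ E → P Y → Q Y x → P (Y ∪ ⁅ x ⁆)) where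

  MaximalIn : Subset n → Set
  MaximalIn Z = Z ⊆ E × P Z × (∀ {x} → x ∈ E → x ∉ Z → ¬ Q Z x)

  maximal-extension : ∀ Y → Y ⊆ E → P Y → Σ (Subset n) MaximalIn
  maximal-extension = <-measure-rec (λ Y → ∣ E ─ Y ∣) Extendable grow
    where
    Extendable : Subset n → Set
    Extendable Y = Y ⊆ E → P Y → Σ (Subset n) MaximalIn
    grow : ∀ Y → (∀ {Y′} → ∣ E ─ Y′ ∣ < ∣ E ─ Y ∣ → Extendable Y′) → Extendable Y
    grow Y grow-below Y⊆E PY with any? (λ x → (x ∈? E) ×-dec ¬? (x ∈? Y) ×-dec Q? Y x)
    ... | no none = Y , Y⊆E , PY , λ x∈E x∉Y QYx → none (_ , x∈E , x∉Y , QYx)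
    ... | yes (x , x∈E , x∉Y , QYx) =
      grow-below shrinks (∪-least Y⊆E (x∈p⇒⁅x⁆⊆p x∈E)) (Q-extends x∈E PY QYx)
      where
      shrinks : ∣ E ─ (Y ∪ ⁅ x ⁆) ∣ < ∣ E ─ Y ∣
      shrinks = subst (λ D → ∣ D ∣ < ∣ E ─ Y ∣) (p─q─r≡p─q∪r E Y ⁅ x ⁆)
                      (x∈p⇒∣p-x∣<∣p∣ (x∈p∧x∉q⇒x∈p─q x∈E x∉Y))

-- Rank functions

Independent : (Subset n → ℕ) → Subset n → Set
Independent r X = r X ≡ ∣ X ∣

IsColoopOf : (Subset n → ℕ) → Subset n → Fin n → Set
IsColoopOf r X x = r (X - x) < r X

restriction : IsMatroid E r → X ⊆ E → IsMatroid X r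
restriction M X⊆E = record
  { rank-bound  = λ A A⊆X → rank-bound A (⊆-trans A⊆X X⊆E)
  ; rank-mono   = λ A B B⊆X → rank-mono A B (⊆-trans B⊆X X⊆E)
  ; rank-submod = λ A B A⊆X B⊆X → rank-submod A B (⊆-trans A⊆X X⊆E) (⊆-trans B⊆X X⊆E)
  }
  where open IsMatroid M

E-flat : IsFlat E r E
E-flat = ⊆-refl , λ _ e∈E e∉E _ → e∉E e∈E

E-modular : IsModularFlat E r E
E-modular {E = E} {r = r} = E-flat {r = r} , λ F (F⊆E , _) → begin
  r E + r F              ≡⟨ +-comm (r E) (r F) ⟩
  r F + r E              ≡⟨ cong₂ (λ A B → r A + r B) (trans (∩-comm E F) (p⊆q⇒p∩q≡p F⊆E))
                                                       (trans (∪-comm E F) (p⊆q⇒p∪q≡q F⊆E)) ⟨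
  r (E ∩ F) + r (E ∪ F)  ∎
  where open ≡-Reasoning

module _ {n} {E : Subset n} {r : Subset n → ℕ} (M : IsMatroid E r) where
  open IsMatroid M

  r⊥≡0 : r ⊥ ≡ 0
  r⊥≡0 = n≤0⇒n≡0 (subst (r ⊥ ≤_) (∣⊥∣≡0 n) (rank-bound ⊥ (⊆-min E)))

  0<r⇒Nonempty : 0 < r X → Nonempty X
  0<r⇒Nonempty {X = X} 0<rX with nonempty? X
  ... | yes nonempty = nonempty
  ... | no empty = ⊥-elim (<-irrefl (sym (trans (cong r (Empty-unique empty)) r⊥≡0)) 0<rX)

  coloop-⊆ : Y ⊆ Z → Z ⊆ E → x ∈ Y → IsColoopOf r Z x → IsColoopOf r Y x
  coloop-⊆ {Y = Y} {Z = Z} {x = x} Y⊆Z Z⊆E x∈Y coloop = +-cancelˡ-≤ (r (Z - x)) _ _ (begin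
    r (Z - x) + suc (r (Y - x))          ≡⟨ +-suc _ _ ⟩
    suc (r (Z - x)) + r (Y - x)          ≤⟨ +-monoˡ-≤ _ coloop ⟩
    r Z + r (Y - x)                      ≤⟨ +-mono-≤ (rank-mono _ _ Y∪Z-x⊆E Z⊆Y∪Z-x)
                                                     (rank-mono _ _ Y∩Z-x⊆E Y-x⊆Y∩Z-x) ⟩
    r (Y ∪ (Z - x)) + r (Y ∩ (Z - x))    ≤⟨ rank-submod Y (Z - x) Y⊆E Z-x⊆E ⟩
    r Y + r (Z - x)                      ≡⟨ +-comm (r Y) _ ⟩
    r (Z - x) + r Y                      ∎)
    where
    open ≤-Reasoning
    Y⊆E = ⊆-trans Y⊆Z Z⊆E
    Z-x⊆E = ⊆-trans (p─q⊆p Z ⁅ x ⁆) Z⊆E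
    Y∪Z-x⊆E = ∪-least Y⊆E Z-x⊆E
    Y∩Z-x⊆E = ⊆-trans (p∩q⊆p Y (Z - x)) Y⊆E
    Z⊆Y∪Z-x : Z ⊆ Y ∪ (Z - x)
    Z⊆Y∪Z-x {z} z∈Z with z ≟ᶠ x
    ... | yes refl = x∈p∪q⁺ (inj₁ x∈Y)
    ... | no z≢x   = x∈p∪q⁺ (inj₂ (x∈p∧x≢y⇒x∈p-y z∈Z z≢x))
    Y-x⊆Y∩Z-x : Y - x ⊆ Y ∩ (Z - x)
    Y-x⊆Y∩Z-x y∈ = let y∈Y , y∉⁅x⁆ = x∈p─q⁻ Y ⁅ x ⁆ y∈
                   in x∈p∩q⁺ (y∈Y , x∈p∧x∉q⇒x∈p─q (Y⊆Z y∈Y) y∉⁅x⁆)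

  coloops⇒independent : Z ⊆ E → (∀ {x} → x ∈ Z → IsColoopOf r Z x) → Independent r Z
  coloops⇒independent {Z = Z} = cardinality-rec Coloops⇒Independent step Z
    where
    Coloops⇒Independent : Subset n → Set
    Coloops⇒Independent Z = Z ⊆ E → (∀ {x} → x ∈ Z → IsColoopOf r Z x) → Independent r Z
    step : ∀ Z → (∀ {Y} → ∣ Y ∣ < ∣ Z ∣ → Coloops⇒Independent Y) → Coloops⇒Independent Z
    step Z ih Z⊆E coloops with nonempty? Z
    ... | no empty =
      subst (Independent r) (sym (Empty-unique empty)) (trans r⊥≡0 (sym (∣⊥∣≡0 n)))
    ... | yes (x , x∈Z) = ≤-antisym (rank-bound Z Z⊆E) (begin
      ∣ Z ∣             ≤⟨ ∣p∣≤1+∣p-x∣ Z x ⟩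
      suc ∣ Z - x ∣     ≡⟨ cong suc (ih (x∈p⇒∣p-x∣<∣p∣ x∈Z) Z-x⊆E coloops′) ⟨
      suc (r (Z - x))   ≤⟨ coloops x∈Z ⟩
      r Z               ∎)
      where
      open ≤-Reasoning
      Z-x⊆Z = p─q⊆p Z ⁅ x ⁆
      Z-x⊆E = ⊆-trans Z-x⊆Z Z⊆E
      coloops′ : ∀ {y} → y ∈ Z - x → IsColoopOf r (Z - x) y
      coloops′ y∈Z-x = coloop-⊆ Z-x⊆Z Z⊆E y∈Z-x (coloops (Z-x⊆Z y∈Z-x))

  independent⇒coloop : Z ⊆ E → Independent r Z → x ∈ Z → IsColoopOf r Z x
  independent⇒coloop {Z = Z} {x = x} Z⊆E independent x∈Z = begin-strict
    r (Z - x)   ≤⟨ rank-bound (Z - x) (⊆-trans (p─q⊆p Z _) Z⊆E) ⟩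
    ∣ Z - x ∣   <⟨ x∈p⇒∣p-x∣<∣p∣ x∈Z ⟩
    ∣ Z ∣       ≡⟨ independent ⟨
    r Z         ∎
    where open ≤-Reasoning

  independent-⊆ : Y ⊆ Z → Z ⊆ E → Independent r Z → Independent r Y
  independent-⊆ Y⊆Z Z⊆E independent = coloops⇒independent (⊆-trans Y⊆Z Z⊆E)
    (λ y∈Y → coloop-⊆ Y⊆Z Z⊆E y∈Y (independent⇒coloop Z⊆E independent (Y⊆Z y∈Y)))

  full-rank-flat : IsFlat E r F → r E ≤ r F → F ≡ E
  full-rank-flat {F = F} (F⊆E , closed) rE≤rF = ⊆-antisym F⊆E E⊆F
    where
    E⊆F : E ⊆ F
    E⊆F {e} e∈E = decidable-stable (e ∈? F) λ e∉F → closed e e∈E e∉F (≤-antisym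
      (≤-trans (rank-mono _ E ⊆-refl F∪e⊆E) rE≤rF)
      (rank-mono F _ F∪e⊆E (p⊆p∪q _)))
      where F∪e⊆E = ∪-least F⊆E (x∈p⇒⁅x⁆⊆p e∈E)

  rank-zero-flat : ∃ λ L → IsFlat E r L × r L ≡ 0
  rank-zero-flat
    with maximal-extension E (λ Y → r Y ≡ 0) (λ Y x → r (Y ∪ ⁅ x ⁆) ≡ r Y) (λ Y x → r (Y ∪ ⁅ x ⁆) ≟ r Y)
           (λ _ rY≡0 rY∪x≡rY → trans rY∪x≡rY rY≡0) ⊥ (⊆-min E) r⊥≡0
  ... | L , L⊆E , rL≡0 , maximal = L , (L⊆E , λ _ → maximal) , rL≡0

-- Direct sums

record IsPartition (E S T : Subset n) : Set where
  field
    S⊆E      : S ⊆ E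
    T⊆E      : T ⊆ E
    disjoint : ∀ {x} → x ∈ S → x ∉ T
    covers   : ∀ {x} → x ∈ E → x ∈ S ⊎ x ∈ T

  split : ∀ {X} → X ⊆ E → X ≡ (X ∩ S) ∪ (X ∩ T)
  split {X} X⊆E = ⊆-antisym
    (λ x∈X → x∈p∪q⁺ (Sum.map (λ x∈S → x∈p∩q⁺ (x∈X , x∈S)) (λ x∈T → x∈p∩q⁺ (x∈X , x∈T))
                              (covers (X⊆E x∈X))))
    (∪-least (p∩q⊆p X S) (p∩q⊆p X T))

  ∣∣-split : ∀ {X} → X ⊆ E → ∣ X ∣ ≡ ∣ X ∩ S ∣ + ∣ X ∩ T ∣
  ∣∣-split {X} X⊆E = trans (cong ∣_∣ (split X⊆E))
    (∣p∪q∣≡∣p∣+∣q∣ (X ∩ S) (X ∩ T) (λ x∈X∩S x∈X∩T → disjoint (p∩q⊆q X S x∈X∩S) (p∩q⊆q X T x∈X∩T)))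

  E∩S≡S : E ∩ S ≡ S
  E∩S≡S = trans (∩-comm E S) (p⊆q⇒p∩q≡p S⊆E)

  E∩T≡T : E ∩ T ≡ T
  E∩T≡T = trans (∩-comm E T) (p⊆q⇒p∩q≡p T⊆E)

  S∪T≡E : S ∪ T ≡ E
  S∪T≡E = trans (cong₂ _∪_ (sym E∩S≡S) (sym E∩T≡T)) (sym (split ⊆-refl))

  ⊆S⇒∩T≡⊥ : ∀ {X} → X ⊆ S → X ∩ T ≡ ⊥
  ⊆S⇒∩T≡⊥ {X} X⊆S = ⊆-antisym
    (λ x∈ → let x∈X , x∈T = x∈p∩q⁻ X T x∈ in ⊥-elim (disjoint (X⊆S x∈X) x∈T)) (⊆-min _)

  ⊆T⇒∩S≡⊥ : ∀ {X} → X ⊆ T → X ∩ S ≡ ⊥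
  ⊆T⇒∩S≡⊥ {X} X⊆T = ⊆-antisym
    (λ x∈ → let x∈X , x∈S = x∈p∩q⁻ X S x∈ in ⊥-elim (disjoint x∈S (X⊆T x∈X))) (⊆-min _)

  ∪-∩ˡ : ∀ {X Y} → X ⊆ S → Y ⊆ T → (X ∪ Y) ∩ S ≡ X
  ∪-∩ˡ {X} {Y} X⊆S Y⊆T = trans (∩-distribʳ-∪ S X Y)
    (trans (cong₂ _∪_ (p⊆q⇒p∩q≡p X⊆S) (⊆T⇒∩S≡⊥ Y⊆T)) (∪-identityʳ X))

  ∪-∩ʳ : ∀ {X Y} → X ⊆ S → Y ⊆ T → (X ∪ Y) ∩ T ≡ Y
  ∪-∩ʳ {X} {Y} X⊆S Y⊆T = trans (∩-distribʳ-∪ T X Y)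
    (trans (cong₂ _∪_ (⊆S⇒∩T≡⊥ X⊆S) (p⊆q⇒p∩q≡p Y⊆T)) (∪-identityˡ Y))

partition-comm : IsPartition E S T → IsPartition E T S
partition-comm P = record
  { S⊆E      = T⊆E
  ; T⊆E      = S⊆E
  ; disjoint = λ x∈T x∈S → disjoint x∈S x∈T
  ; covers   = λ x∈E → Sum.swap (covers x∈E)
  }
  where open IsPartition P

partition-restrict : IsPartition E S T → F ⊆ E → IsPartition F (F ∩ S) (F ∩ T)
partition-restrict {S = S} {T = T} {F = F} P F⊆E = record
  { S⊆E      = p∩q⊆p F S
  ; T⊆E      = p∩q⊆p F T
  ; disjoint = λ x∈F∩S x∈F∩T → disjoint (p∩q⊆q F S x∈F∩S) (p∩q⊆q F T x∈F∩T)
  ; covers   = λ x∈F → Sum.map (λ x∈S → x∈p∩q⁺ (x∈F , x∈S)) (λ x∈T → x∈p∩q⁺ (x∈F , x∈T))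
                                (covers (F⊆E x∈F))
  }
  where open IsPartition P

record IsDirectSum (E S T : Subset n) (r : Subset n → ℕ) : Set where
  field
    partition     : IsPartition E S T
    rank-additive : ∀ {X} → X ⊆ E → r X ≡ r (X ∩ S) + r (X ∩ T)

  open IsPartition partition public

  rank-∪ : ∀ {X Y} → X ⊆ S → Y ⊆ T → r (X ∪ Y) ≡ r X + r Y
  rank-∪ X⊆S Y⊆T = trans (rank-additive (∪-least (⊆-trans X⊆S S⊆E) (⊆-trans Y⊆T T⊆E)))
                         (cong₂ _+_ (cong r (∪-∩ˡ X⊆S Y⊆T)) (cong r (∪-∩ʳ X⊆S Y⊆T)))

  rank-E : r E ≡ r S + r T
  rank-E = trans (rank-additive ⊆-refl) (cong₂ _+_ (cong r E∩S≡S) (cong r E∩T≡T))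

  rank-∩-additive : ∀ {X Y} → X ⊆ E →
    r (X ∩ Y) ≡ r ((X ∩ S) ∩ (Y ∩ S)) + r ((X ∩ T) ∩ (Y ∩ T))
  rank-∩-additive {X} {Y} X⊆E = trans (rank-additive (⊆-trans (p∩q⊆p X Y) X⊆E))
    (cong₂ _+_ (cong r ([p∩q]∩s≡[p∩s]∩[q∩s] X Y S)) (cong r ([p∩q]∩s≡[p∩s]∩[q∩s] X Y T)))

  rank-∪-additive : ∀ {X Y} → X ⊆ E → Y ⊆ E →
    r (X ∪ Y) ≡ r ((X ∩ S) ∪ (Y ∩ S)) + r ((X ∩ T) ∪ (Y ∩ T))
  rank-∪-additive {X} {Y} X⊆E Y⊆E = trans (rank-additive (∪-least X⊆E Y⊆E))
    (cong₂ _+_ (cong r (∩-distribʳ-∪ S X Y)) (cong r (∩-distribʳ-∪ T X Y)))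

⊕-comm : IsDirectSum E S T r → IsDirectSum E T S r
⊕-comm {r = r} D = record
  { partition     = partition-comm partition
  ; rank-additive = λ X⊆E → trans (rank-additive X⊆E) (+-comm (r _) _)
  }
  where open IsDirectSum D

⊕-restrict : IsDirectSum E S T r → F ⊆ E → IsDirectSum F (F ∩ S) (F ∩ T) r
⊕-restrict {r = r} D F⊆E = record
  { partition     = partition-restrict partition F⊆E
  ; rank-additive = λ X⊆F → trans (rank-additive (⊆-trans X⊆F F⊆E))
      (sym (cong₂ _+_ (cong r (p⊆q⇒p∩[q∩s]≡p∩s X⊆F)) (cong r (p⊆q⇒p∩[q∩s]≡p∩s X⊆F))))
  }
  where open IsDirectSum D

flat-∩ˡ : IsDirectSum E S T r → IsFlat E r F → IsFlat S r (F ∩ S)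
flat-∩ˡ {S = S} {T = T} {r = r} {F = F} D (F⊆E , closed) = p∩q⊆q F S , λ e e∈S e∉F∩S r-unchanged →
  closed e (S⊆E e∈S) (λ e∈F → e∉F∩S (x∈p∩q⁺ (e∈F , e∈S))) (begin
    r (F ∪ ⁅ e ⁆)
      ≡⟨ rank-∪-additive F⊆E (x∈p⇒⁅x⁆⊆p (S⊆E e∈S)) ⟩
    r ((F ∩ S) ∪ (⁅ e ⁆ ∩ S)) + r ((F ∩ T) ∪ (⁅ e ⁆ ∩ T))
      ≡⟨ cong₂ (λ A B → r ((F ∩ S) ∪ A) + r ((F ∩ T) ∪ B))
               (p⊆q⇒p∩q≡p (x∈p⇒⁅x⁆⊆p e∈S)) (⊆S⇒∩T≡⊥ (x∈p⇒⁅x⁆⊆p e∈S)) ⟩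
    r ((F ∩ S) ∪ ⁅ e ⁆) + r ((F ∩ T) ∪ ⊥)
      ≡⟨ cong₂ _+_ r-unchanged (cong r (∪-identityʳ _)) ⟩
    r (F ∩ S) + r (F ∩ T)
      ≡⟨ rank-additive F⊆E ⟨
    r F ∎)
  where
  open IsDirectSum D
  open ≡-Reasoning

flat-∪-closedˡ : IsDirectSum E S T r → IsFlat S r X → Y ⊆ T → x ∈ S → x ∉ X →
  r ((X ∪ Y) ∪ ⁅ x ⁆) ≢ r (X ∪ Y)
flat-∪-closedˡ {r = r} {X = X} {Y = Y} {x = x} D (X⊆S , closed) Y⊆T x∈S x∉X r-unchanged =
  closed x x∈S x∉X (+-cancelʳ-≡ (r Y) _ _ (begin
    r (X ∪ ⁅ x ⁆) + r Y       ≡⟨ rank-∪ (∪-least X⊆S (x∈p⇒⁅x⁆⊆p x∈S)) Y⊆T ⟨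
    r ((X ∪ ⁅ x ⁆) ∪ Y)       ≡⟨ cong r ([p∪q]∪s≡[p∪s]∪q X Y ⁅ x ⁆) ⟨
    r ((X ∪ Y) ∪ ⁅ x ⁆)       ≡⟨ r-unchanged ⟩
    r (X ∪ Y)                 ≡⟨ rank-∪ X⊆S Y⊆T ⟩
    r X + r Y                 ∎))
  where
  open IsDirectSum D
  open ≡-Reasoning

flat-∪ : IsDirectSum E S T r → IsFlat S r X → IsFlat T r Y → IsFlat E r (X ∪ Y)
flat-∪ {E = E} {r = r} {X = X} {Y = Y} D X-flat@(X⊆S , _) Y-flat@(Y⊆T , _) =
  ∪-least (⊆-trans X⊆S S⊆E) (⊆-trans Y⊆T T⊆E) , closed
  where
  open IsDirectSum D
  closed : ∀ e → e ∈ E → e ∉ X ∪ Y → r ((X ∪ Y) ∪ ⁅ e ⁆) ≢ r (X ∪ Y)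
  closed e e∈E e∉X∪Y with covers e∈E
  ... | inj₁ e∈S = flat-∪-closedˡ D X-flat Y⊆T e∈S (λ e∈X → e∉X∪Y (p⊆p∪q Y e∈X))
  ... | inj₂ e∈T = subst (λ Z → r (Z ∪ ⁅ e ⁆) ≢ r Z) (∪-comm Y X)
    (flat-∪-closedˡ (⊕-comm D) Y-flat X⊆S e∈T (λ e∈Y → e∉X∪Y (q⊆p∪q X Y e∈Y)))

flat-of-parts : IsDirectSum E S T r → F ⊆ E →
  IsFlat S r (F ∩ S) → IsFlat T r (F ∩ T) → IsFlat E r F
flat-of-parts {E = E} {r = r} D F⊆E FS-flat FT-flat =
  subst (IsFlat E r) (sym (IsDirectSum.split D F⊆E)) (flat-∪ D FS-flat FT-flat)

modular-of-parts : IsDirectSum E S T r → F ⊆ E →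
  IsModularFlat S r (F ∩ S) → IsModularFlat T r (F ∩ T) → IsModularFlat E r F
modular-of-parts {E = E} {S = S} {T = T} {r = r} {F = F} D F⊆E (FS-flat , FS-modular) (FT-flat , FT-modular) =
  flat-of-parts D F⊆E FS-flat FT-flat , modular
  where
  open IsDirectSum D
  open ≡-Reasoning
  modular : ∀ F′ → IsFlat E r F′ → r F + r F′ ≡ r (F ∩ F′) + r (F ∪ F′)
  modular F′ F′-flat@(F′⊆E , _) = begin
    r F + r F′
      ≡⟨ cong₂ _+_ (rank-additive F⊆E) (rank-additive F′⊆E) ⟩
    (r FS + r FT) + (r F′S + r F′T)
      ≡⟨ +-interchange (r FS) _ _ _ ⟩
    (r FS + r F′S) + (r FT + r F′T)
      ≡⟨ cong₂ _+_ (FS-modular F′S (flat-∩ˡ D F′-flat)) (FT-modular F′T (flat-∩ˡ (⊕-comm D) F′-flat)) ⟩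
    (r (FS ∩ F′S) + r (FS ∪ F′S)) + (r (FT ∩ F′T) + r (FT ∪ F′T))
      ≡⟨ +-interchange (r (FS ∩ F′S)) _ _ _ ⟩
    (r (FS ∩ F′S) + r (FT ∩ F′T)) + (r (FS ∪ F′S) + r (FT ∪ F′T))
      ≡⟨ cong₂ _+_ (rank-∩-additive F⊆E) (rank-∪-additive F⊆E F′⊆E) ⟨
    r (F ∩ F′) + r (F ∪ F′) ∎
    where
    FS = F ∩ S
    FT = F ∩ T
    F′S = F′ ∩ S
    F′T = F′ ∩ T

modular-∪ : IsDirectSum E S T r → IsModularFlat S r X → IsModularFlat T r Y → IsModularFlat E r (X ∪ Y)
modular-∪ {S = S} {T = T} {r = r} D X-modular@((X⊆S , _) , _) Y-modular@((Y⊆T , _) , _) =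
  modular-of-parts D (∪-least (⊆-trans X⊆S S⊆E) (⊆-trans Y⊆T T⊆E))
    (subst (IsModularFlat S r) (sym (∪-∩ˡ X⊆S Y⊆T)) X-modular)
    (subst (IsModularFlat T r) (sym (∪-∩ʳ X⊆S Y⊆T)) Y-modular)
  where open IsDirectSum D

-- F′ ∪ T is a flat of M; comparing the modular equations for F and F′ ∪ T leaves the one for F ∩ S and F′.
modular-∩ˡ : IsDirectSum E S T r → IsModularFlat E r F → IsModularFlat S r (F ∩ S)
modular-∩ˡ {E = E} {S = S} {T = T} {r = r} {F = F} D (F-flat@(F⊆E , _) , F-modular) =
  flat-∩ˡ D F-flat , modular
  where
  open IsDirectSum D
  open ≡-Reasoning
  FS = F ∩ S
  FT = F ∩ T
  modular : ∀ F′ → IsFlat S r F′ → r FS + r F′ ≡ r (FS ∩ F′) + r (FS ∪ F′)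
  modular F′ F′-flat@(F′⊆S , _) = +-cancelʳ-≡ (r FT + r T) _ _ (begin
    (r FS + r F′) + (r FT + r T)
      ≡⟨ +-interchange (r FS) _ _ _ ⟩
    (r FS + r FT) + (r F′ + r T)
      ≡⟨ cong₂ _+_ (rank-additive F⊆E) (rank-∪ F′⊆S ⊆-refl) ⟨
    r F + r G
      ≡⟨ F-modular G (flat-∪ D F′-flat (E-flat {r = r})) ⟩
    r (F ∩ G) + r (F ∪ G)
      ≡⟨ cong₂ _+_ (rank-∩-additive F⊆E) (rank-∪-additive F⊆E G⊆E) ⟩
    (r (FS ∩ (G ∩ S)) + r (FT ∩ (G ∩ T))) + (r (FS ∪ (G ∩ S)) + r (FT ∪ (G ∩ T)))
      ≡⟨ cong₂ (λ A B → (r (FS ∩ A) + r (FT ∩ B)) + (r (FS ∪ A) + r (FT ∪ B))) G∩S≡F′ G∩T≡T ⟩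
    (r (FS ∩ F′) + r (FT ∩ T)) + (r (FS ∪ F′) + r (FT ∪ T))
      ≡⟨ cong₂ (λ A B → (r (FS ∩ F′) + r A) + (r (FS ∪ F′) + r B))
               (p⊆q⇒p∩q≡p (p∩q⊆q F T)) (p⊆q⇒p∪q≡q (p∩q⊆q F T)) ⟩
    (r (FS ∩ F′) + r FT) + (r (FS ∪ F′) + r T)
      ≡⟨ +-interchange (r (FS ∩ F′)) _ _ _ ⟩
    (r (FS ∩ F′) + r (FS ∪ F′)) + (r FT + r T) ∎)
    where
    G = F′ ∪ T
    G⊆E : G ⊆ E
    G⊆E = ∪-least (⊆-trans F′⊆S S⊆E) T⊆E
    G∩S≡F′ : G ∩ S ≡ F′
    G∩S≡F′ = ∪-∩ˡ F′⊆S ⊆-refl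
    G∩T≡T : G ∩ T ≡ T
    G∩T≡T = ∪-∩ʳ F′⊆S ⊆-refl

-- Separators

CircuitsDoNotCross : Subset n → (Subset n → ℕ) → Subset n → Subset n → Set
CircuitsDoNotCross E r S T = ∀ {C s t} → IsCircuit E r C → s ∈ C → t ∈ C → s ∈ S → t ∉ T

RankAdditiveOn : (Subset n → ℕ) → Subset n → Subset n → Subset n → Set
RankAdditiveOn r S T X = r X ≡ r (X ∩ S) + r (X ∩ T)

module _ {n} {E S T : Subset n} {r : Subset n → ℕ} (M : IsMatroid E r) (P : IsPartition E S T) where
  open IsMatroid M
  open IsPartition P

  rank-subadditive-parts : X ⊆ E → r X ≤ r (X ∩ S) + r (X ∩ T)
  rank-subadditive-parts {X} X⊆E = subst (λ Z → r Z ≤ r (X ∩ S) + r (X ∩ T)) (sym (split X⊆E))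
    (≤-trans (m≤m+n _ _)
             (rank-submod (X ∩ S) (X ∩ T) (⊆-trans (p∩q⊆p X S) X⊆E) (⊆-trans (p∩q⊆p X T) X⊆E)))

  minimal-nonadditive⇒coloop : X ⊆ E → r X < r (X ∩ S) + r (X ∩ T) →
    (∀ {x} → x ∈ X → RankAdditiveOn r S T (X - x)) → ∀ {a} → a ∈ X ∩ S → IsColoopOf r (X ∩ S) a
  minimal-nonadditive⇒coloop {X} X⊆E nonadditive additive-below {a} a∈X∩S =
    +-cancelʳ-< (r (X ∩ T)) _ _ (begin-strict
      r ((X ∩ S) - a) + r (X ∩ T)         ≡⟨ cong₂ (λ A B → r A + r B) ([p─q]∩s≡[p∩s]─q X ⁅ a ⁆ S)
                                                                     ([p─q]∩s≡p∩s X ⁅ a ⁆ T a∉T) ⟨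
      r ((X - a) ∩ S) + r ((X - a) ∩ T)   ≡⟨ additive-below (p∩q⊆p X S a∈X∩S) ⟨
      r (X - a)                           ≤⟨ rank-mono (X - a) X X⊆E (p─q⊆p X ⁅ a ⁆) ⟩
      r X                                 <⟨ nonadditive ⟩
      r (X ∩ S) + r (X ∩ T)               ∎)
    where
    open ≤-Reasoning
    a∉T : ∀ {x} → x ∈ ⁅ a ⁆ → x ∉ T
    a∉T x∈⁅a⁆ = disjoint (subst (_∈ S) (sym (x∈⁅y⁆⇒x≡y a x∈⁅a⁆)) (p∩q⊆q X S a∈X∩S))

-- Both parts of X are independent, because each of their elements is a coloop; hence every X - x is.
minimal-nonadditive⇒crossing-circuit : IsMatroid E r → IsPartition E S T → X ⊆ E →
  r X < r (X ∩ S) + r (X ∩ T) → (∀ {x} → x ∈ X → RankAdditiveOn r S T (X - x)) →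
  IsCircuit E r X × Nonempty (X ∩ S) × Nonempty (X ∩ T)
minimal-nonadditive⇒crossing-circuit {E = E} {r = r} {S = S} {T = T} {X = X} M P X⊆E nonadditive additive-below =
  (X⊆E , dependent , minimal) , 0<r⇒Nonempty M 0<rA , 0<r⇒Nonempty M 0<rB
  where
  open IsMatroid M
  open IsPartition P
  A = X ∩ S
  B = X ∩ T
  A⊆E = ⊆-trans (p∩q⊆p X S) X⊆E
  B⊆E = ⊆-trans (p∩q⊆p X T) X⊆E
  A-independent : Independent r A
  A-independent = coloops⇒independent M A⊆E (minimal-nonadditive⇒coloop M P X⊆E nonadditive additive-below)
  B-independent : Independent r B
  B-independent = coloops⇒independent M B⊆E
    (minimal-nonadditive⇒coloop M (partition-comm P) X⊆E (subst (r X <_) (+-comm (r A) (r B)) nonadditive)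
      (λ {x} x∈X → trans (additive-below x∈X) (+-comm (r ((X - x) ∩ S)) _)))
  X-x-independent : ∀ {x} → x ∈ X → Independent r (X - x)
  X-x-independent {x} x∈X = begin
    r (X - x)                              ≡⟨ additive-below x∈X ⟩
    r ((X - x) ∩ S) + r ((X - x) ∩ T)      ≡⟨ cong₂ _+_
                                                (independent-⊆ M (p⊆q⇒p∩s⊆q∩s S X-x⊆X) A⊆E A-independent)
                                                (independent-⊆ M (p⊆q⇒p∩s⊆q∩s T X-x⊆X) B⊆E B-independent) ⟩
    ∣ (X - x) ∩ S ∣ + ∣ (X - x) ∩ T ∣      ≡⟨ ∣∣-split (⊆-trans X-x⊆X X⊆E) ⟨
    ∣ X - x ∣                              ∎
    where
    open ≡-Reasoning
    X-x⊆X = p─q⊆p X ⁅ x ⁆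
  dependent : r X < ∣ X ∣
  dependent = <-≤-trans nonadditive
    (≤-reflexive (trans (cong₂ _+_ A-independent B-independent) (sym (∣∣-split X⊆E))))
  minimal : ∀ Y → Y ⊆ X → Y ≢ X → Independent r Y
  minimal Y Y⊆X Y≢X with ⊆∧≢⇒⊂ Y⊆X Y≢X
  ... | _ , x , x∈X , x∉Y =
    independent-⊆ M Y⊆X-x (⊆-trans (p─q⊆p X ⁅ x ⁆) X⊆E) (X-x-independent x∈X)
    where
    Y⊆X-x : Y ⊆ X - x
    Y⊆X-x y∈Y = x∈p∧x≢y⇒x∈p-y (Y⊆X y∈Y) (λ y≡x → x∉Y (subst (_∈ Y) y≡x y∈Y))
  0<rA : 0 < r A
  0<rA = +-cancelʳ-< (r B) 0 (r A) (≤-<-trans (rank-mono B X X⊆E (p∩q⊆p X T)) nonadditive)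
  0<rB : 0 < r B
  0<rB = +-cancelˡ-< (r A) 0 (r B)
    (≤-<-trans (subst (_≤ r X) (sym (+-identityʳ (r A))) (rank-mono A X X⊆E (p∩q⊆p X S))) nonadditive)

separator⇒⊕ : IsMatroid E r → IsPartition E S T → CircuitsDoNotCross E r S T → IsDirectSum E S T r
separator⇒⊕ {E = E} {r = r} {S = S} {T = T} M P do-not-cross = record
  { partition = P
  ; rank-additive = λ {X} → cardinality-rec (λ X → X ⊆ E → RankAdditiveOn r S T X) additive X
  }
  where
  additive : ∀ X → (∀ {Y} → ∣ Y ∣ < ∣ X ∣ → Y ⊆ E → RankAdditiveOn r S T Y) →
    X ⊆ E → RankAdditiveOn r S T X
  additive X additive-below X⊆E = ≤-antisym (rank-subadditive-parts M P X⊆E) (≮⇒≥ crossing)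
    where
    crossing : ¬ r X < r (X ∩ S) + r (X ∩ T)
    crossing nonadditive with minimal-nonadditive⇒crossing-circuit M P X⊆E nonadditive
      (λ x∈X → additive-below (x∈p⇒∣p-x∣<∣p∣ x∈X) (⊆-trans (p─q⊆p X _) X⊆E))
    ... | circuit , (s , s∈X∩S) , (t , t∈X∩T) =
      do-not-cross circuit (p∩q⊆p X S s∈X∩S) (p∩q⊆p X T t∈X∩T) (p∩q⊆q X S s∈X∩S) (p∩q⊆q X T t∈X∩T)

-- Connected components

isCircuit? : ∀ (E : Subset n) r X → Dec (IsCircuit E r X)
isCircuit? E r X = (X ⊆? E) ×-dec (r X <? ∣ X ∣) ×-dec
  allSubsets? (λ Y → (Y ⊆? X) →-dec (¬? (≡-dec Bool._≟_ Y X) →-dec (r Y ≟ ∣ Y ∣)))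

shareCircuit? : ∀ (E : Subset n) r x y → Dec (ShareCircuit E r x y)
shareCircuit? E r x y = anySubset? (λ C → isCircuit? E r C ×-dec (x ∈? C) ×-dec (y ∈? C))

circuit-restrict : IsCircuit E r X → X ⊆ F → IsCircuit F r X
circuit-restrict (_ , dependent , minimal) X⊆F = X⊆F , dependent , minimal

circuit-extend : IsCircuit F r X → F ⊆ E → IsCircuit E r X
circuit-extend (X⊆F , dependent , minimal) F⊆E = ⊆-trans X⊆F F⊆E , dependent , minimal

shareCircuit⇒∈ : ShareCircuit E r x y → y ∈ E
shareCircuit⇒∈ (_ , (C⊆E , _) , _ , y∈C) = C⊆E y∈C

component-exists : x ∈ E → ∃ λ C → x ∈ C × IsComponent E r C
component-exists {x = x} {E = E} {r = r} x∈E
  with maximal-extension E Reachable Linked (λ Y y → any? (λ z → (z ∈? Y) ×-dec shareCircuit? E r z y))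
         extend ⁅ x ⁆ (x∈p⇒⁅x⁆⊆p x∈E) (x∈⁅x⁆ x , λ y∈⁅x⁆ → subst (Star _ x) (sym (x∈⁅y⁆⇒x≡y x y∈⁅x⁆)) ε)
  where
  Reachable : Subset _ → Set
  Reachable Y = x ∈ Y × (∀ {y} → y ∈ Y → Star (ShareCircuit E r) x y)
  Linked : Subset _ → Fin _ → Set
  Linked Y y = ∃ λ z → z ∈ Y × ShareCircuit E r z y
  extend : ∀ {Y y} → y ∈ E → Reachable Y → Linked Y y → Reachable (Y ∪ ⁅ y ⁆)
  extend {Y} {y} _ (x∈Y , reach) (z , z∈Y , share) = p⊆p∪q _ x∈Y , λ w∈ → [ reach , reach-y ] (x∈p∪q⁻ Y ⁅ y ⁆ w∈)
    where
    reach-y : ∀ {w} → w ∈ ⁅ y ⁆ → Star (ShareCircuit E r) x w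
    reach-y w∈⁅y⁆ = subst (Star _ x) (sym (x∈⁅y⁆⇒x≡y y w∈⁅y⁆)) (reach z∈Y ◅◅ (share ◅ ε))
... | C , C⊆E , (x∈C , reach) , maximal =
  C , x∈C , x , x∈E , λ y → mk⇔ (λ y∈C → C⊆E y∈C , reach y∈C) (λ (_ , path) → closed x∈C path)
  where
  closed : ∀ {y z} → y ∈ C → Star (ShareCircuit E r) y z → z ∈ C
  closed y∈C ε = y∈C
  closed {y} y∈C (_◅_ {j = w} share path) = closed w∈C path
    where
    w∈C = decidable-stable (w ∈? C) (λ w∉C → maximal (shareCircuit⇒∈ share) w∉C (y , y∈C , share))

module _ {n} {E C : Subset n} {r : Subset n → ℕ} (C-component : IsComponent E r C) where
  private
    member = proj₂ (proj₂ C-component)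

  component-partition : IsPartition E C (E ─ C)
  component-partition = record
    { S⊆E      = λ {y} y∈C → proj₁ (Equivalence.to (member y) y∈C)
    ; T⊆E      = p─q⊆p E C
    ; disjoint = λ y∈C y∈E─C → proj₂ (x∈p─q⁻ E C y∈E─C) y∈C
    ; covers   = λ {y} y∈E → Sum.map id (x∈p∧x∉q⇒x∈p─q y∈E) (toSum (y ∈? C))
    }

  component-circuits-do-not-cross : CircuitsDoNotCross E r C (E ─ C)
  component-circuits-do-not-cross {X} {s} {t} circuit@(X⊆E , _) s∈X t∈X s∈C t∈E─C =
    proj₂ (x∈p─q⁻ E C t∈E─C) (Equivalence.from (member t)
      (X⊆E t∈X , proj₂ (Equivalence.to (member s) s∈C) ◅◅ ((X , circuit , s∈X , t∈X) ◅ ε)))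

  component-⊕ : IsMatroid E r → IsDirectSum E C (E ─ C) r
  component-⊕ M = separator⇒⊕ M component-partition component-circuits-do-not-cross

  component-of-complement : ∀ {C′} → IsComponent (E ─ C) r C′ → IsComponent E r C′
  component-of-complement (x′ , x′∈E─C , member′) = x′ , p─q⊆p E C x′∈E─C , λ y → mk⇔
    (λ y∈C′ → let y∈E─C , path = Equivalence.to (member′ y) y∈C′
              in p─q⊆p E C y∈E─C , gmap id share-in-E path)
    (λ (_ , path) → Equivalence.from (member′ y) (path-within x′∈E─C path))
    where
    share-in-E : ∀ {y z} → ShareCircuit (E ─ C) r y z → ShareCircuit E r y z
    share-in-E (X , circuit , y∈X , z∈X) = X , circuit-extend circuit (p─q⊆p E C) , y∈X , z∈X
    circuit-within : ∀ {X y} → IsCircuit E r X → y ∈ X → y ∈ E ─ C → X ⊆ E ─ C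
    circuit-within circuit@(X⊆E , _) y∈X y∈E─C {w} w∈X with w ∈? C
    ... | yes w∈C = ⊥-elim (component-circuits-do-not-cross circuit w∈X y∈X w∈C y∈E─C)
    ... | no w∉C  = x∈p∧x∉q⇒x∈p─q (X⊆E w∈X) w∉C
    path-within : ∀ {y z} → y ∈ E ─ C → Star (ShareCircuit E r) y z →
      z ∈ E ─ C × Star (ShareCircuit (E ─ C) r) y z
    path-within y∈E─C ε = y∈E─C , ε
    path-within y∈E─C ((X , circuit , y∈X , w∈X) ◅ path) =
      let X⊆E─C = circuit-within circuit y∈X y∈E─C
          z∈E─C , path′ = path-within (X⊆E─C w∈X) path
      in z∈E─C , (X , circuit-restrict circuit X⊆E─C , y∈X , w∈X) ◅ path′

componentwise : (P : Subset n → Set) →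
  (∀ {E} → IsMatroid E r → Empty E → P E) →
  (∀ {E S T} → IsMatroid E r → IsDirectSum E S T r → P E ⇔ (P S × P T)) →
  IsMatroid E r → P E ⇔ (∀ C → IsComponent E r C → P C)
componentwise {r = r} {E = E} P P-empty P-⊕ M = mk⇔
  (λ PE C C-component → proj₁ (Equivalence.to (P-⊕ M (component-⊕ C-component M)) PE))
  (cardinality-rec FromComponents fromComponents E M)
  where
  FromComponents : Subset _ → Set
  FromComponents E = IsMatroid E r → (∀ C → IsComponent E r C → P C) → P E
  fromComponents : ∀ E → (∀ {E′} → ∣ E′ ∣ < ∣ E ∣ → FromComponents E′) → FromComponents E
  fromComponents E fromComponents-below M P-components with nonempty? E
  ... | no empty = P-empty M empty
  ... | yes (x , x∈E) with component-exists {r = r} x∈E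
  ...   | C , x∈C , C-component = Equivalence.from (P-⊕ M (component-⊕ C-component M))
    ( P-components C C-component
    , fromComponents-below (p∩q≢∅⇒∣p─q∣<∣p∣ E C (x , x∈p∩q⁺ (x∈E , x∈C))) (restriction M (p─q⊆p E C))
        (λ C′ C′-component → P-components C′ (component-of-complement C-component C′-component)))

-- Saturation

verticalCover-∪ʳ : IsDirectSum E S T r → HasVerticalCover S r → HasVerticalCover E r
verticalCover-∪ʳ {E = E} {S = S} {T = T} {r = r} D (A₁ , A₂ , A₁-flat , A₂-flat , A₁≢S , A₂≢S , A₁∪A₂≡S) =
  A₁ ∪ T , A₂ ∪ T , flat-∪ D A₁-flat (E-flat {r = r}) , flat-∪ D A₂-flat (E-flat {r = r}) ,
  proper A₁-flat A₁≢S , proper A₂-flat A₂≢S , cover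
  where
  open IsDirectSum D
  open ≡-Reasoning
  proper : ∀ {A} → IsFlat S r A → A ≢ S → A ∪ T ≢ E
  proper {A} (A⊆S , _) A≢S A∪T≡E = A≢S (begin
    A             ≡⟨ ∪-∩ˡ A⊆S ⊆-refl ⟨
    (A ∪ T) ∩ S   ≡⟨ cong (_∩ S) A∪T≡E ⟩
    E ∩ S         ≡⟨ E∩S≡S ⟩
    S             ∎)
  cover : (A₁ ∪ T) ∪ (A₂ ∪ T) ≡ E
  cover = begin
    (A₁ ∪ T) ∪ (A₂ ∪ T)   ≡⟨ [p∪s]∪[q∪s]≡[p∪q]∪s A₁ A₂ T ⟩
    (A₁ ∪ A₂) ∪ T         ≡⟨ cong (_∪ T) A₁∪A₂≡S ⟩
    S ∪ T                 ≡⟨ S∪T≡E ⟩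
    E                     ∎

-- Every flat of M|T has full rank, hence is T; so a proper flat of M meets S in a proper flat of M|S.
verticalCover-∩ˡ : IsMatroid E r → IsDirectSum E S T r → r T ≡ 0 →
  HasVerticalCover E r → HasVerticalCover S r
verticalCover-∩ˡ {E = E} {r = r} {S = S} {T = T} M D rT≡0 (G₁ , G₂ , G₁-flat , G₂-flat , G₁≢E , G₂≢E , G₁∪G₂≡E) =
  G₁ ∩ S , G₂ ∩ S , flat-∩ˡ D G₁-flat , flat-∩ˡ D G₂-flat , proper G₁-flat G₁≢E , proper G₂-flat G₂≢E , cover
  where
  open IsDirectSum D
  open ≡-Reasoning
  proper : ∀ {G} → IsFlat E r G → G ≢ E → G ∩ S ≢ S
  proper {G} G-flat@(G⊆E , _) G≢E G∩S≡S = G≢E (begin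
    G                     ≡⟨ split G⊆E ⟩
    (G ∩ S) ∪ (G ∩ T)     ≡⟨ cong₂ _∪_ G∩S≡S G∩T≡T ⟩
    S ∪ T                 ≡⟨ S∪T≡E ⟩
    E                     ∎)
    where
    G∩T≡T : G ∩ T ≡ T
    G∩T≡T = full-rank-flat (restriction M T⊆E) (flat-∩ˡ (⊕-comm D) G-flat)
                           (subst (_≤ r (G ∩ T)) (sym rT≡0) z≤n)
  cover : (G₁ ∩ S) ∪ (G₂ ∩ S) ≡ S
  cover = begin
    (G₁ ∩ S) ∪ (G₂ ∩ S)   ≡⟨ ∩-distribʳ-∪ S G₁ G₂ ⟨
    (G₁ ∪ G₂) ∩ S         ≡⟨ cong (_∩ S) G₁∪G₂≡E ⟩
    E ∩ S                 ≡⟨ E∩S≡S ⟩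
    S                     ∎

round-∩ˡ : IsDirectSum E S T r → IsRoundFlat E r F → IsRoundFlat S r (F ∩ S)
round-∩ˡ D (F-flat@(F⊆E , _) , no-cover) =
  flat-∩ˡ D F-flat , λ cover → no-cover (verticalCover-∪ʳ (⊕-restrict D F⊆E) cover)

saturated-⊕ : IsDirectSum E S T r → IsSaturated S r → IsSaturated T r → IsSaturated E r
saturated-⊕ D S-saturated T-saturated F F-round@((F⊆E , _) , _) =
  modular-of-parts D F⊆E (S-saturated _ (round-∩ˡ D F-round)) (T-saturated _ (round-∩ˡ (⊕-comm D) F-round))

saturated-∩ˡ : IsMatroid E r → IsDirectSum E S T r → IsSaturated E r → IsSaturated S r
saturated-∩ˡ {E = E} {r = r} {S = S} M D E-saturated A (A-flat@(A⊆S , _) , A-round)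
  with rank-zero-flat (restriction M (IsDirectSum.T⊆E D))
... | L , L-flat@(L⊆T , _) , rL≡0 =
  subst (IsModularFlat S r) (∪-∩ˡ A⊆S L⊆T) (modular-∩ˡ D (E-saturated (A ∪ L) (A∪L-flat , A∪L-round)))
  where
  open IsDirectSum D
  A∪L-flat : IsFlat E r (A ∪ L)
  A∪L-flat = flat-∪ D A-flat L-flat
  A⊕L : IsDirectSum (A ∪ L) A L r
  A⊕L = subst₂ (λ S′ T′ → IsDirectSum (A ∪ L) S′ T′ r) (∪-∩ˡ A⊆S L⊆T) (∪-∩ʳ A⊆S L⊆T)
               (⊕-restrict D (proj₁ A∪L-flat))
  A∪L-round : ¬ HasVerticalCover (A ∪ L) r
  A∪L-round cover = A-round (verticalCover-∩ˡ (restriction M (proj₁ A∪L-flat)) A⊕L rL≡0 cover)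

saturated-of-empty : Empty E → IsSaturated E r
saturated-of-empty {E = E} {r = r} empty F ((F⊆E , _) , _) =
  subst (IsModularFlat E r) (⊆-antisym (λ x∈E → ⊥-elim (empty (_ , x∈E))) F⊆E) E-modular

saturated-⊕⇔ : IsMatroid E r → IsDirectSum E S T r →
  IsSaturated E r ⇔ (IsSaturated S r × IsSaturated T r)
saturated-⊕⇔ M D = mk⇔
  (λ saturated → saturated-∩ˡ M D saturated , saturated-∩ˡ M (⊕-comm D) saturated)
  (λ (S-saturated , T-saturated) → saturated-⊕ D S-saturated T-saturated)

-- Supersolvability

record MonotoneSection (g : ℕ → ℕ) (N m : ℕ) : Set where
  field
    φ        : ℕ → ℕ
    bounded  : ∀ {j} → j ≤ m → φ j ≤ N
    section  : ∀ {j} → j ≤ m → g (φ j) ≡ j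
    monotone : ∀ {j k} → j ≤ k → k ≤ m → φ j ≤ φ k

unit-steps⇒monotoneSection : ∀ (g : ℕ → ℕ) N → g 0 ≡ 0 →
  (∀ {i} → i < N → g (suc i) ≤ suc (g i)) → ∀ {m} → m ≤ g N → MonotoneSection g N m
unit-steps⇒monotoneSection g zero g0≡0 _ m≤g0 = record
  { φ        = λ _ → 0
  ; bounded  = λ _ → z≤n
  ; section  = λ j≤m → trans g0≡0 (sym (n≤0⇒n≡0 (≤-trans j≤m (≤-trans m≤g0 (≤-reflexive g0≡0)))))
  ; monotone = λ _ _ → z≤n
  }
unit-steps⇒monotoneSection g (suc N) g0≡0 unit-step {m} m≤gN+1 with m ≤? g N
... | yes m≤gN = record
  { φ = φ ; bounded = λ j≤m → m≤n⇒m≤1+n (bounded j≤m) ; section = section ; monotone = monotone }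
  where open MonotoneSection (unit-steps⇒monotoneSection g N g0≡0 (λ i<N → unit-step (m<n⇒m<1+n i<N)) m≤gN)
... | no m≰gN = record { φ = φ′ ; bounded = bounded′ ; section = section′ ; monotone = monotone′ }
  where
  open MonotoneSection (unit-steps⇒monotoneSection g N g0≡0 (λ i<N → unit-step (m<n⇒m<1+n i<N)) ≤-refl)
  m≡g[N+1] : m ≡ g (suc N)
  m≡g[N+1] = ≤-antisym m≤gN+1 (≤-trans (unit-step ≤-refl) (≰⇒> m≰gN))
  φ′ : ℕ → ℕ
  φ′ j with j ≤? g N
  ... | yes _ = φ j
  ... | no _  = suc N
  bounded′ : ∀ {j} → j ≤ m → φ′ j ≤ suc N
  bounded′ {j} _ with j ≤? g N
  ... | yes j≤gN = m≤n⇒m≤1+n (bounded j≤gN)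
  ... | no _     = ≤-refl
  section′ : ∀ {j} → j ≤ m → g (φ′ j) ≡ j
  section′ {j} j≤m with j ≤? g N
  ... | yes j≤gN = section j≤gN
  ... | no j≰gN  = ≤-antisym (≤-trans (unit-step ≤-refl) (≰⇒> j≰gN)) (≤-trans j≤m (≤-reflexive m≡g[N+1]))
  monotone′ : ∀ {j k} → j ≤ k → k ≤ m → φ′ j ≤ φ′ k
  monotone′ {j} {k} j≤k k≤m with j ≤? g N | k ≤? g N
  ... | yes j≤gN | yes k≤gN = monotone j≤k k≤gN
  ... | yes j≤gN | no _     = m≤n⇒m≤1+n (bounded j≤gN)
  ... | no j≰gN  | yes k≤gN = ⊥-elim (j≰gN (≤-trans j≤k k≤gN))
  ... | no _     | no _     = ≤-refl

-- The chain of IsSupersolvable, indexed by ℕ; only the indices i ≤ r E matter.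
record ModularChain (E : Subset n) (r : Subset n → ℕ) : Set where
  field
    chain    : ℕ → Subset n
    modular  : ∀ {i} → i ≤ r E → IsModularFlat E r (chain i)
    rank     : ∀ {i} → i ≤ r E → r (chain i) ≡ i
    monotone : ∀ {i j} → i ≤ j → j ≤ r E → chain i ⊆ chain j

  chain⊆E : ∀ {i} → i ≤ r E → chain i ⊆ E
  chain⊆E i≤rE = proj₁ (proj₁ (modular i≤rE))

supersolvable⇔modularChain : IsSupersolvable E r ⇔ ModularChain E r
supersolvable⇔modularChain {E = E} {r = r} = mk⇔
  (λ (F , modular , rank , monotone) → record
    { chain    = λ i → F (i mod suc (r E))
    ; modular  = λ _ → modular _
    ; rank     = λ i≤rE → trans (rank _) (toℕ-mod i≤rE)
    ; monotone = λ i≤j j≤rE → monotone _ _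
        (subst₂ _≤_ (sym (toℕ-mod (≤-trans i≤j j≤rE))) (sym (toℕ-mod j≤rE)) i≤j)
    })
  (λ F → let open ModularChain F in
    (λ i → chain (toℕ i)) , (λ i → modular (toℕ≤pred[n] i)) , (λ i → rank (toℕ≤pred[n] i)) ,
    (λ i j i≤j {x} → monotone i≤j (toℕ≤pred[n] j)))
  where
  toℕ-mod : ∀ {i m} → i ≤ m → toℕ (i mod suc m) ≡ i
  toℕ-mod i≤m = trans (toℕ-fromℕ< _) (m<n⇒m%n≡m (s≤s i≤m))

modularChain-⊕ : IsDirectSum E S T r → ModularChain S r → ModularChain T r → ModularChain E r
modularChain-⊕ {E = E} {S = S} {T = T} {r = r} D G H = record
  { chain    = λ i → G.chain (r S ⊓ i) ∪ H.chain (i ∸ r S)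
  ; modular  = λ i≤rE → modular-∪ D (G.modular (m⊓n≤m _ _)) (H.modular (∸-bound i≤rE))
  ; rank     = λ {i} i≤rE → begin
      r (G.chain (r S ⊓ i) ∪ H.chain (i ∸ r S))
        ≡⟨ rank-∪ (G.chain⊆E (m⊓n≤m _ _)) (H.chain⊆E (∸-bound i≤rE)) ⟩
      r (G.chain (r S ⊓ i)) + r (H.chain (i ∸ r S))
        ≡⟨ cong₂ _+_ (G.rank (m⊓n≤m _ _)) (H.rank (∸-bound i≤rE)) ⟩
      (r S ⊓ i) + (i ∸ r S)
        ≡⟨ m⊓n+n∸m≡n (r S) i ⟩
      i ∎
  ; monotone = λ i≤j j≤rE → ∪-least
      (⊆-trans (G.monotone (⊓-monoʳ-≤ (r S) i≤j) (m⊓n≤m _ _)) (p⊆p∪q _))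
      (⊆-trans (H.monotone (∸-monoˡ-≤ (r S) i≤j) (∸-bound j≤rE)) (q⊆p∪q _ _))
  }
  where
  module G = ModularChain G
  module H = ModularChain H
  open IsDirectSum D
  open ≡-Reasoning
  ∸-bound : ∀ {i} → i ≤ r E → i ∸ r S ≤ r T
  ∸-bound {i} i≤rE = m≤n+o⇒m∸n≤o i (r S) (subst (i ≤_) rank-E i≤rE)

modularChain-∩ˡ : IsMatroid E r → IsDirectSum E S T r → ModularChain E r → ModularChain S r
modularChain-∩ˡ {E = E} {r = r} {S = S} {T = T} M D F = record
  { chain    = λ j → F.chain (φ j) ∩ S
  ; modular  = λ j≤rS → modular-∩ˡ D (F.modular (bounded j≤rS))
  ; rank     = section
  ; monotone = λ j≤k k≤rS → p⊆q⇒p∩s⊆q∩s S (F.monotone (monotone j≤k k≤rS) (bounded k≤rS))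
  }
  where
  module F = ModularChain F
  open IsDirectSum D
  open IsMatroid M using (rank-mono)
  g h : ℕ → ℕ
  g i = r (F.chain i ∩ S)
  h i = r (F.chain i ∩ T)
  g0≡0 : g 0 ≡ 0
  g0≡0 = n≤0⇒n≡0 (≤-trans (rank-mono _ _ (F.chain⊆E z≤n) (p∩q⊆p _ S)) (≤-reflexive (F.rank z≤n)))
  unit-step : ∀ {i} → i < r E → g (suc i) ≤ suc (g i)
  unit-step {i} i<rE = +-cancelʳ-≤ (h (suc i)) _ _ (begin
    g (suc i) + h (suc i)  ≡⟨ rank-additive (F.chain⊆E i<rE) ⟨
    r (F.chain (suc i))    ≡⟨ F.rank i<rE ⟩
    suc i                  ≡⟨ cong suc (F.rank (<⇒≤ i<rE)) ⟨
    suc (r (F.chain i))    ≡⟨ cong suc (rank-additive (F.chain⊆E (<⇒≤ i<rE))) ⟩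
    suc (g i + h i)        ≤⟨ +-monoʳ-≤ (suc (g i)) h-monotone ⟩
    suc (g i) + h (suc i)  ∎)
    where
    open ≤-Reasoning
    h-monotone : h i ≤ h (suc i)
    h-monotone = rank-mono _ _ (⊆-trans (p∩q⊆p _ T) (F.chain⊆E i<rE))
                               (p⊆q⇒p∩s⊆q∩s T (F.monotone (n≤1+n i) i<rE))
  top≡E : F.chain (r E) ≡ E
  top≡E = full-rank-flat M (proj₁ (F.modular ≤-refl)) (≤-reflexive (sym (F.rank ≤-refl)))
  rS≤g[rE] : r S ≤ g (r E)
  rS≤g[rE] = ≤-reflexive (sym (trans (cong (λ Z → r (Z ∩ S)) top≡E) (cong r E∩S≡S)))
  open MonotoneSection (unit-steps⇒monotoneSection g (r E) g0≡0 unit-step rS≤g[rE])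

modularChain-of-empty : IsMatroid E r → Empty E → ModularChain E r
modularChain-of-empty {E = E} {r = r} M empty = record
  { chain    = λ _ → E
  ; modular  = λ _ → E-modular
  ; rank     = λ {i} i≤rE → trans rE≡0 (sym (n≤0⇒n≡0 (subst (i ≤_) rE≡0 i≤rE)))
  ; monotone = λ _ _ → ⊆-refl
  }
  where
  rE≡0 : r E ≡ 0
  rE≡0 = trans (cong r (Empty-unique empty)) (r⊥≡0 M)

supersolvable-⊕⇔ : IsMatroid E r → IsDirectSum E S T r →
  IsSupersolvable E r ⇔ (IsSupersolvable S r × IsSupersolvable T r)
supersolvable-⊕⇔ {r = r} M D = mk⇔
  (λ E-supersolvable → let F = toChain E-supersolvable in
    fromChain (modularChain-∩ˡ M D F) , fromChain (modularChain-∩ˡ M (⊕-comm D) F))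
  (λ (S-supersolvable , T-supersolvable) →
    fromChain (modularChain-⊕ D (toChain S-supersolvable) (toChain T-supersolvable)))
  where
  toChain : ∀ {X} → IsSupersolvable X r → ModularChain X r
  toChain = Equivalence.to supersolvable⇔modularChain
  fromChain : ∀ {X} → ModularChain X r → IsSupersolvable X r
  fromChain = Equivalence.from supersolvable⇔modularChain

supersolvable-of-empty : IsMatroid E r → Empty E → IsSupersolvable E r
supersolvable-of-empty M empty = Equivalence.from supersolvable⇔modularChain (modularChain-of-empty M empty)

mainTheorem13 : (n : ℕ) (E : Subset n) (r : Subset n → ℕ) → IsMatroid E r →
    (IsSupersolvable E r ⇔ (∀ C → IsComponent E r C → IsSupersolvable C r))
    × (IsSaturated E r ⇔ (∀ C → IsComponent E r C → IsSaturated C r))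
mainTheorem13 n E r M =
    componentwise (λ X → IsSupersolvable X r) supersolvable-of-empty supersolvable-⊕⇔ M
  , componentwise (λ X → IsSaturated X r) (λ _ → saturated-of-empty) saturated-⊕⇔ M
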